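{- Let $G=(S\cup K,E)$ be a split graph on $n$ vertices, where $S$ is an independent set and $K$ is a clique of $G$, and assume $K$ is a maximum clique, i.e. $\omega(G)=|K|$. Then $$Tr(G)+Tr(\overline{G})=\begin{cases} n+2 & \text{if, in } G, \text{ every vertex of } K \text{ has a neighbour in } S,\\ n+1 & \text{otherwise.}\end{cases}$$
   Context: All graphs are finite and simple; $\overline{G}$ is the complement of $G$. For disjoint $A,B\subseteq V$, $A$ dominates $B$ if every vertex of $B$ is adjacent to at least one vertex of $A$. A transitive $k$-partition of $G=(V,E)$ is a partition $\{V_1,\dots,V_k\}$ of $V$ into $k$ nonempty parts such that $V_i$ dominates $V_j$ for all $1\le i<j\le k$; the transitivity $Tr(G)$ is the maximum such $k$. A split graph is a graph whose vertex set can be partitioned into an independent set and a clique; $\omega(G)$ is the size of a maximum clique. -}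

module Defs where

open import Data.Nat using (ℕ; _≤_)
open import Data.Fin using (Fin) renaming (_<_ to _<ᶠ_)
open import Data.Fin.Subset using (Subset; _∈_; ∁; ∣_∣)
open import Data.Product using (Σ; ∃; ∃-syntax; _×_; _,_)
open import Relation.Nullary using (¬_)
open import Relation.Binary using (Decidable)
open import Relation.Binary.PropositionalEquality using (_≡_; _≢_)

record Graph (n : ℕ) : Set₁ where
  field
    Adj     : Fin n → Fin n → Set
    adj?    : Decidable Adj
    adj-sym : ∀ {u v} → Adj u v → Adj v u
    irrefl  : ∀ {v} → ¬ Adj v v
open Graph public

complement : ∀ {n} → Graph n → Graph n
complement {n} G = record
  { Adj = λ u v → (u ≢ v) × ¬ Adj G u v
  ; adj? = dec
  ; adj-sym = λ { (ne , na) → (λ e → ne (Relation.Binary.PropositionalEquality.sym e)) , (λ a → na (Graph.adj-sym G a)) }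
  ; irrefl = λ { (ne , _) → ne _≡_.refl }
  }
  where
  open import Relation.Nullary using (yes; no)
  open import Data.Fin using (_≟_)
  dec : Decidable (λ u v → (u ≢ v) × ¬ Adj G u v)
  dec u v with u ≟ v | adj? G u v
  ... | yes e | _ = no (λ { (ne , _) → ne e })
  ... | no ne | yes a = no (λ { (_ , na) → na a })
  ... | no ne | no na = yes (ne , na)

IsClique : ∀ {n} → Graph n → Subset n → Set
IsClique G C = ∀ u v → u ∈ C → v ∈ C → u ≢ v → Adj G u v

IsIndependent : ∀ {n} → Graph n → Subset n → Set
IsIndependent G I = ∀ u v → u ∈ I → v ∈ I → ¬ Adj G u v

IsMaximumClique : ∀ {n} → Graph n → Subset n → Set
IsMaximumClique G K = IsClique G K × (∀ C → IsClique G C → ∣ C ∣ ≤ ∣ K ∣)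

IsTransitivePartition : ∀ {n} → Graph n → (k : ℕ) → (Fin n → Fin k) → Set
IsTransitivePartition {n} G k p =
  (∀ (i : Fin k) → ∃[ v ] p v ≡ i) ×
  (∀ (i j : Fin k) → i <ᶠ j → ∀ v → p v ≡ j → ∃[ u ] (p u ≡ i × Adj G u v))

HasTransitivePartition : ∀ {n} → Graph n → ℕ → Set
HasTransitivePartition {n} G k = Σ (Fin n → Fin k) (IsTransitivePartition G k)

IsTransitivity : ∀ {n} → Graph n → ℕ → Set
IsTransitivity G t = HasTransitivePartition G t × (∀ k → HasTransitivePartition G k → k ≤ t)

{-# OPTIONS --safe #-}
module Submission where

-- Call C a vertex cover when its complement is independent. In a transitive partition at
-- most one part V_j misses C: a part below V_j contains a dominator of a vertex of V_j,
-- which must lie in C, and a part above V_j is dominated vertex by vertex from V_j, so it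
-- lies inside C. Hence Tr ≤ |C| + 1, and Tr ≤ |C| if some x ∈ C has no neighbour outside C,
-- since then even C ∖ {x} meets all parts but one. Conversely, a clique B whose vertices all
-- have neighbours outside B yields the transitive partition V ∖ B, {b₁}, …, {b_|B|}. This
-- applies to K in G when K is dominated by S, to K ∖ {x} in G otherwise, and to S in the
-- complement, where maximality of K gives every vertex of S a neighbour in K.

open import Defs
open import Data.Nat using (ℕ; zero; suc; _+_; _≤_; z≤n; s≤s)
open import Data.Nat.Properties using (≤-trans; m+[n∸m]≡n; +-suc; +-comm; <⇒≱)
open import Data.Fin using (Fin; zero; suc; fromℕ<; punchIn; _≟_) renaming (_<_ to _<ᶠ_)
open import Data.Fin.Properties
  using (suc-injective; <-cmp; <-irrefl; punchIn-injective; punchInᵢ≢i; any?; all?; ¬∀⟶∃¬)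
open import Data.Fin.Subset using (Subset; _∈_; _∉_; ∁; ∣_∣; _-_; _∪_; ⁅_⁆; inside; outside; Nonempty)
open import Data.Fin.Subset.Properties
open import Data.Vec using (_∷_; here; there)
open import Data.Product using (∃-syntax; _×_; _,_; proj₁; proj₂)
open import Data.Sum using (inj₁; inj₂)
open import Function using (_∘_)
open import Function.Definitions using (Injective)
open import Relation.Binary using (tri<; tri≈; tri>)
open import Relation.Binary.PropositionalEquality
  using (_≡_; _≢_; refl; sym; trans; cong; subst; module ≡-Reasoning)
open import Relation.Nullary using (¬_; Dec; yes; no; contradiction)
open import Relation.Nullary.Decidable using (_×-dec_; _→-dec_; ¬?)

private
  variable
    k m n : ℕ

suc∣p-x∣≡∣p∣ : ∀ {x : Fin n} {p : Subset n} → x ∈ p → suc ∣ p - x ∣ ≡ ∣ p ∣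
suc∣p-x∣≡∣p∣ {x = zero}  {inside ∷ p}  here        = cong suc (cong ∣_∣ (p─⊥≡p p))
suc∣p-x∣≡∣p∣ {x = suc x} {inside ∷ p}  (there x∈p) = cong suc (suc∣p-x∣≡∣p∣ x∈p)
suc∣p-x∣≡∣p∣ {x = suc x} {outside ∷ p} (there x∈p) = suc∣p-x∣≡∣p∣ x∈p

∣p∣+∣∁p∣≡n : ∀ (p : Subset n) → ∣ p ∣ + ∣ ∁ p ∣ ≡ n
∣p∣+∣∁p∣≡n p = trans (cong (∣ p ∣ +_) (∣∁p∣≡n∸∣p∣ p)) (m+[n∸m]≡n (∣p∣≤n p))

x∉p-x : ∀ {x : Fin n} {p : Subset n} → x ∉ p - x
x∉p-x {x = zero}  {_ ∷ p} ()
x∉p-x {x = suc x} {_ ∷ p} (there x∈p-x) = x∉p-x x∈p-x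

injective⇒≤∣p∣ : ∀ {p : Subset n} (f : Fin m → Fin n) → Injective _≡_ _≡_ f →
                 (∀ i → f i ∈ p) → m ≤ ∣ p ∣
injective⇒≤∣p∣ {m = zero}  f _ _ = z≤n
injective⇒≤∣p∣ {m = suc m} f f-injective f∈p =
  ≤-trans (s≤s (injective⇒≤∣p∣ (f ∘ suc) (suc-injective ∘ f-injective) f∘suc∈p-f₀))
          (x∈p⇒∣p-x∣<∣p∣ (f∈p zero))
  where
  f∘suc∈p-f₀ : ∀ i → f (suc i) ∈ _ - f zero
  f∘suc∈p-f₀ i = x∈p∧x≢y⇒x∈p-y (f∈p (suc i)) (λ e → contradiction (f-injective e) λ ())

IsVertexCover : Graph n → Subset n → Set
IsVertexCover H C = IsIndependent H (∁ C)

Meets : (Fin n → Fin k) → Subset n → Fin k → Set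
Meets p D l = ∃[ v ] (p v ≡ l × v ∈ D)

meets? : (p : Fin n → Fin k) (D : Subset n) (l : Fin k) → Dec (Meets p D l)
meets? p D l = any? λ v → (p v ≟ l) ×-dec (v ∈? D)

meets-minus : ∀ {p : Fin n → Fin k} {D x l} → Meets p D l → l ≢ p x → Meets p (D - x) l
meets-minus {p = p} (v , pv≡l , v∈D) l≢px =
  v , pv≡l , x∈p∧x≢y⇒x∈p-y v∈D (λ v≡x → l≢px (trans (sym pv≡l) (cong p v≡x)))

meetsAllBut⇒≤ : ∀ (p : Fin n → Fin k) {D} (j : Fin k) →
                (∀ l → l ≢ j → Meets p D l) → k ≤ suc ∣ D ∣
meetsAllBut⇒≤ {k = suc k} p j meets =
  s≤s (injective⇒≤∣p∣ witness witness-injective (proj₂ ∘ proj₂ ∘ meets′))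
  where
  meets′ : ∀ i → Meets p _ (punchIn j i)
  meets′ i = meets (punchIn j i) (punchInᵢ≢i j i)

  witness : Fin k → Fin _
  witness = proj₁ ∘ meets′

  witness-injective : Injective _≡_ _≡_ witness
  witness-injective {a} {b} e = punchIn-injective j a b (begin
    punchIn j a    ≡⟨ sym (proj₁ (proj₂ (meets′ a))) ⟩
    p (witness a)  ≡⟨ cong p e ⟩
    p (witness b)  ≡⟨ proj₁ (proj₂ (meets′ b)) ⟩
    punchIn j b    ∎)
    where open ≡-Reasoning

module _ {n} (H : Graph n) {C : Subset n} (cover : IsVertexCover H C)
         {k} {p : Fin n → Fin k} (tp : IsTransitivePartition H k p)
         {j : Fin k} (missing : ¬ Meets p C j) where

  missing⇒∈∁ : ∀ {w} → p w ≡ j → w ∈ ∁ C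
  missing⇒∈∁ pw≡j = x∉p⇒x∈∁p (λ w∈C → missing (_ , pw≡j , w∈C))

  belowMissing-dominator∈C : ∀ {l w} → l <ᶠ j → p w ≡ j → ∃[ u ] (p u ≡ l × u ∈ C × Adj H u w)
  belowMissing-dominator∈C {l} {w} l<j pw≡j with proj₂ tp l j l<j w pw≡j
  ... | u , pu≡l , u~w =
    u , pu≡l , x∉∁p⇒x∈p (λ u∈∁C → cover u w u∈∁C (missing⇒∈∁ pw≡j) u~w) , u~w

  aboveMissing⊆C : ∀ {l r} → j <ᶠ l → p r ≡ l → r ∈ C
  aboveMissing⊆C {l} {r} j<l pr≡l with proj₂ tp j l j<l r pr≡l
  ... | z , pz≡j , z~r = x∉∁p⇒x∈p (λ r∈∁C → cover z r (missing⇒∈∁ pz≡j) r∈∁C z~r)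

  othersMeet : ∀ l → l ≢ j → Meets p C l
  othersMeet l l≢j with <-cmp l j
  ... | tri< l<j _ _ = let (w , pw≡j) = proj₁ tp j
                           (u , pu≡l , u∈C , _) = belowMissing-dominator∈C l<j pw≡j
                       in u , pu≡l , u∈C
  ... | tri≈ _ l≡j _ = contradiction l≡j l≢j
  ... | tri> _ _ j<l = let (r , pr≡l) = proj₁ tp l in r , pr≡l , aboveMissing⊆C j<l pr≡l

module _ {n} (H : Graph n) {C : Subset n} (cover : IsVertexCover H C) where

  vertexCover⇒k≤suc∣C∣ : ∀ {k} → HasTransitivePartition H k → k ≤ suc ∣ C ∣
  vertexCover⇒k≤suc∣C∣ {zero}  _        = z≤n
  vertexCover⇒k≤suc∣C∣ {suc k} (p , tp) with all? (meets? p C)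
  ... | yes all-meet = meetsAllBut⇒≤ p zero (λ l _ → all-meet l)
  ... | no ¬all-meet with ¬∀⟶∃¬ _ _ (meets? p C) ¬all-meet
  ... | j , missing = meetsAllBut⇒≤ p j (othersMeet H cover tp missing)

  module _ {x : Fin n} (x∈C : x ∈ C) (isolated : ∀ u → u ∈ ∁ C → ¬ Adj H u x)
           {k} {p : Fin n → Fin k} (tp : IsTransitivePartition H k p) where

    allButOneMeetMinus : ∃[ j ] ∀ l → l ≢ j → Meets p (C - x) l
    allButOneMeetMinus with all? (meets? p C)
    ... | yes all-meet = p x , λ l → meets-minus (all-meet l)
    ... | no ¬all-meet with ¬∀⟶∃¬ _ _ (meets? p C) ¬all-meet
    ... | j , missing with <-cmp (p x) j
    ... | tri≈ _ px≡j _ = contradiction (x , px≡j , x∈C) missing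
    ... | tri> _ _ j<px = let (z , pz≡j , z~x) = proj₂ tp j (p x) j<px x refl
                          in contradiction z~x (isolated z (missing⇒∈∁ H cover tp missing pz≡j))
    ... | tri< px<j _ _ = j , othersMeetMinus
      where
      othersMeetMinus : ∀ l → l ≢ j → Meets p (C - x) l
      othersMeetMinus l l≢j with l ≟ p x
      ... | no l≢px = meets-minus (othersMeet H cover tp missing l l≢j) l≢px
      ... | yes refl =
        let (w , pw≡j) = proj₁ tp j
            (u , pu≡l , u∈C , u~w) = belowMissing-dominator∈C H cover tp missing px<j pw≡j
            w∈∁C = missing⇒∈∁ H cover tp missing pw≡j
        in u , pu≡l ,
           x∈p∧x≢y⇒x∈p-y u∈C (λ u≡x → isolated w w∈∁C (adj-sym H (subst (λ y → Adj H y w) u≡x u~w)))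

  isolatedVertexCover⇒k≤∣C∣ : ∀ {x} → x ∈ C → (∀ u → u ∈ ∁ C → ¬ Adj H u x) →
                              ∀ {k} → HasTransitivePartition H k → k ≤ ∣ C ∣
  isolatedVertexCover⇒k≤∣C∣ x∈C isolated (p , tp) =
    let (j , meets) = allButOneMeetMinus x∈C isolated tp
    in subst (_ ≤_) (suc∣p-x∣≡∣p∣ x∈C) (meetsAllBut⇒≤ p j meets)

-- The 1-based position of v among the elements of B, and 0 for v ∉ B.
position : (B : Subset n) → Fin n → Fin (suc ∣ B ∣)
position (inside  ∷ B) zero    = suc zero
position (outside ∷ B) zero    = zero
position (inside  ∷ B) (suc v) = punchIn (suc zero) (position B v)
position (outside ∷ B) (suc v) = position B v

position-∉ : ∀ {B : Subset n} {v} → v ∉ B → position B v ≡ zero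
position-∉ {B = inside  ∷ B} {zero}  v∉B = contradiction here v∉B
position-∉ {B = outside ∷ B} {zero}  v∉B = refl
position-∉ {B = inside  ∷ B} {suc v} v∉B = cong (punchIn (suc zero)) (position-∉ (v∉B ∘ there))
position-∉ {B = outside ∷ B} {suc v} v∉B = position-∉ (v∉B ∘ there)

position-suc⇒∈ : ∀ {B : Subset n} {v i} → position B v ≡ suc i → v ∈ B
position-suc⇒∈ pv≡suc = x∉∁p⇒x∈p (λ v∈∁B →
  contradiction (trans (sym (position-∉ (x∈∁p⇒x∉p v∈∁B))) pv≡suc) λ ())

position-onto : ∀ (B : Subset n) i → ∃[ v ] position B v ≡ suc i
position-onto (inside  ∷ B) zero    = zero , refl
position-onto (inside  ∷ B) (suc i) = let (v , pv≡i) = position-onto B i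
                                      in suc v , cong (punchIn (suc zero)) pv≡i
position-onto (outside ∷ B) i       = let (v , pv≡i) = position-onto B i in suc v , pv≡i

module _ {n} (H : Graph n) where

  dominatedClique-transitivePartition : ∀ {B} → IsClique H B → (∃[ v ] v ∈ ∁ B) →
    (∀ v → v ∈ B → ∃[ u ] (u ∈ ∁ B × Adj H u v)) → HasTransitivePartition H (suc ∣ B ∣)
  dominatedClique-transitivePartition {B} clique (v₀ , v₀∈∁B) dominated =
    position B , onto , dominates
    where
    onto : ∀ i → ∃[ v ] position B v ≡ i
    onto zero    = v₀ , position-∉ (x∈∁p⇒x∉p v₀∈∁B)
    onto (suc i) = position-onto B i

    dominates : ∀ i j → i <ᶠ j → ∀ v → position B v ≡ j → ∃[ u ] (position B u ≡ i × Adj H u v)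
    dominates zero (suc j) _ v pv≡j =
      let (u , u∈∁B , u~v) = dominated v (position-suc⇒∈ pv≡j)
      in u , position-∉ (x∈∁p⇒x∉p u∈∁B) , u~v
    dominates (suc i) (suc j) i<j v pv≡j =
      let (u , pu≡i) = position-onto B i
      in u , pu≡i , clique u v (position-suc⇒∈ pu≡i) (position-suc⇒∈ pv≡j)
                      (λ u≡v → <-irrefl (trans (sym pu≡i) (trans (cong (position B) u≡v) pv≡j)) i<j)

  dominatedClique-transitivity : ∀ {B} → IsClique H B → IsVertexCover H B → (∃[ v ] v ∈ ∁ B) →
    (∀ v → v ∈ B → ∃[ u ] (u ∈ ∁ B × Adj H u v)) → IsTransitivity H (suc ∣ B ∣)
  dominatedClique-transitivity clique cover nonfull dominated =
    dominatedClique-transitivePartition clique nonfull dominated ,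
    λ _ → vertexCover⇒k≤suc∣C∣ H cover

  -- The construction applied to K - x, where x dominates every other vertex of K.
  clique-transitivePartition : ∀ {K x} → IsClique H K → x ∈ K → HasTransitivePartition H ∣ K ∣
  clique-transitivePartition {K} {x} clique x∈K =
    subst (HasTransitivePartition H) (suc∣p-x∣≡∣p∣ x∈K)
      (dominatedClique-transitivePartition
        (λ u v u∈ v∈ → clique u v (p─q⊆p K ⁅ x ⁆ u∈) (p─q⊆p K ⁅ x ⁆ v∈))
        (x , x∉p⇒x∈∁p x∉p-x)
        (λ v v∈ → x , x∉p⇒x∈∁p x∉p-x , clique x v x∈K (p─q⊆p K ⁅ x ⁆ v∈)
                                           (λ x≡v → x∉p-x (subst (_∈ K - x) (sym x≡v) v∈))))

  isolatedVertexClique-transitivity : ∀ {K x} → IsClique H K → IsVertexCover H K → x ∈ K →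
    (∀ u → u ∈ ∁ K → ¬ Adj H u x) → IsTransitivity H ∣ K ∣
  isolatedVertexClique-transitivity clique cover x∈K isolated =
    clique-transitivePartition clique x∈K , λ _ → isolatedVertexCover⇒k≤∣C∣ H cover x∈K isolated

  undominated-vertex : ∀ {B : Subset n} → ¬ (∀ v → v ∈ B → ∃[ u ] (u ∈ ∁ B × Adj H u v)) →
                       ∃[ x ] (x ∈ B × ∀ u → u ∈ ∁ B → ¬ Adj H u x)
  undominated-vertex {B} ¬dominated =
    let (x , ¬x-dominated) = ¬∀⟶∃¬ n _ dominated? ¬dominated
    in x , x∉∁p⇒x∈p (λ x∈∁B → ¬x-dominated (λ x∈B → contradiction x∈B (x∈∁p⇒x∉p x∈∁B))) ,
       λ u u∈∁B u~x → ¬x-dominated (λ _ → u , u∈∁B , u~x)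
    where
    dominated? : ∀ v → Dec (v ∈ B → ∃[ u ] (u ∈ ∁ B × Adj H u v))
    dominated? v = (v ∈? B) →-dec any? (λ u → (u ∈? ∁ B) ×-dec adj? H u v)

  clique-∪-⁅⁆ : ∀ {K v} → IsClique H K → (∀ u → u ∈ K → Adj H u v) → IsClique H (K ∪ ⁅ v ⁆)
  clique-∪-⁅⁆ {K} {v} clique ~v u w u∈ w∈ u≢w with x∈p∪q⁻ K ⁅ v ⁆ u∈ | x∈p∪q⁻ K ⁅ v ⁆ w∈
  ... | inj₁ u∈K | inj₁ w∈K = clique u w u∈K w∈K u≢w
  ... | inj₁ u∈K | inj₂ w∈v = subst (Adj H u) (sym (x∈⁅y⁆⇒x≡y v w∈v)) (~v u u∈K)
  ... | inj₂ u∈v | inj₁ w∈K = subst (λ y → Adj H y w) (sym (x∈⁅y⁆⇒x≡y v u∈v)) (adj-sym H (~v w w∈K))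
  ... | inj₂ u∈v | inj₂ w∈v = contradiction (trans (x∈⁅y⁆⇒x≡y v u∈v) (sym (x∈⁅y⁆⇒x≡y v w∈v))) u≢w

  module _ {K : Subset n} (maximal : IsMaximumClique H K) where

    maximumClique-nonNeighbour : ∀ {v} → v ∉ K → ∃[ u ] (u ∈ K × ¬ Adj H u v)
    maximumClique-nonNeighbour {v} v∉K with any? (λ u → (u ∈? K) ×-dec ¬? (adj? H u v))
    ... | yes nonNeighbour = nonNeighbour
    ... | no ¬nonNeighbour =
      contradiction (proj₂ maximal _ (clique-∪-⁅⁆ (proj₁ maximal) ~v))
                    (<⇒≱ (p⊂q⇒∣p∣<∣q∣ (p⊆p∪q ⁅ v ⁆ , v , q⊆p∪q K ⁅ v ⁆ (x∈⁅x⁆ v) , v∉K)))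
      where
      ~v : ∀ u → u ∈ K → Adj H u v
      ~v u u∈K with adj? H u v
      ... | yes u~v = u~v
      ... | no ¬u~v = contradiction (u , u∈K , ¬u~v) ¬nonNeighbour

    maximumClique-nonempty : Fin n → Nonempty K
    maximumClique-nonempty z with nonempty? K
    ... | yes nonempty = nonempty
    ... | no empty = contradiction (proj₂ maximal ⁅ z ⁆ singleton-clique) ∣⁅z⁆∣≰∣K∣
      where
      singleton-clique : IsClique H ⁅ z ⁆
      singleton-clique u w u∈ w∈ u≢w =
        contradiction (trans (x∈⁅y⁆⇒x≡y z u∈) (sym (x∈⁅y⁆⇒x≡y z w∈))) u≢w
      ∣⁅z⁆∣≰∣K∣ : ¬ ∣ ⁅ z ⁆ ∣ ≤ ∣ K ∣
      ∣⁅z⁆∣≰∣K∣ rewrite ∣⁅x⁆∣≡1 z | Empty-unique empty | ∣⊥∣≡0 n = λ ()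

module _ {n} (H : Graph n) where

  independent⇒complement-clique : ∀ {I} → IsIndependent H I → IsClique (complement H) I
  independent⇒complement-clique independent u v u∈I v∈I u≢v = u≢v , independent u v u∈I v∈I

  clique⇒complement-vertexCover∁ : ∀ {K} → IsClique H K → IsVertexCover (complement H) (∁ K)
  clique⇒complement-vertexCover∁ clique u v u∈ v∈ (u≢v , ¬u~v) =
    ¬u~v (clique u v (x∉∁p⇒x∈p (x∈∁p⇒x∉p u∈)) (x∉∁p⇒x∈p (x∈∁p⇒x∉p v∈)) u≢v)

  maximumClique-complement-transitivity : ∀ {K} → IsVertexCover H K → IsMaximumClique H K →
    Fin n → IsTransitivity (complement H) (suc ∣ ∁ K ∣)
  maximumClique-complement-transitivity {K} cover maximal z =
    dominatedClique-transitivity (complement H) (independent⇒complement-clique cover)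
      (clique⇒complement-vertexCover∁ (proj₁ maximal))
      (let (k , k∈K) = maximumClique-nonempty H maximal z in k , ∈⇒∈∁∁ k∈K)
      (λ s s∈∁K →
        let s∉K = x∈∁p⇒x∉p s∈∁K
            (y , y∈K , ¬y~s) = maximumClique-nonNeighbour H maximal s∉K
        in y , ∈⇒∈∁∁ y∈K , (λ y≡s → s∉K (subst (_∈ K) y≡s y∈K)) , ¬y~s)
    where
    ∈⇒∈∁∁ : ∀ {x} → x ∈ K → x ∈ ∁ (∁ K)
    ∈⇒∈∁∁ = x∉p⇒x∈∁p ∘ x∈p⇒x∉∁p

theorem4 : ∀ {n} → 1 ≤ n → (G : Graph n) → (K : Subset n) →
    IsClique G K → IsIndependent G (∁ K) → IsMaximumClique G K →
    ((∀ v → v ∈ K → ∃[ u ] (u ∈ ∁ K × Adj G u v)) →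
       ∃[ t₁ ] ∃[ t₂ ] (IsTransitivity G t₁ × IsTransitivity (complement G) t₂ × t₁ + t₂ ≡ n + 2))
    × (¬ (∀ v → v ∈ K → ∃[ u ] (u ∈ ∁ K × Adj G u v)) →
       ∃[ t₁ ] ∃[ t₂ ] (IsTransitivity G t₁ × IsTransitivity (complement G) t₂ × t₁ + t₂ ≡ n + 1))
theorem4 {n} 1≤n G K clique cover maximal = dominated-case , undominated-case
  where
  vertex : Fin n
  vertex = fromℕ< 1≤n

  Tr-complement : IsTransitivity (complement G) (suc ∣ ∁ K ∣)
  Tr-complement = maximumClique-complement-transitivity G cover maximal vertex

  sizes : ∣ K ∣ + suc ∣ ∁ K ∣ ≡ n + 1
  sizes = begin
    ∣ K ∣ + suc ∣ ∁ K ∣   ≡⟨ +-suc ∣ K ∣ ∣ ∁ K ∣ ⟩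
    suc (∣ K ∣ + ∣ ∁ K ∣) ≡⟨ cong suc (∣p∣+∣∁p∣≡n K) ⟩
    suc n                 ≡⟨ +-comm 1 n ⟩
    n + 1                 ∎
    where open ≡-Reasoning

  dominated-case : (∀ v → v ∈ K → ∃[ u ] (u ∈ ∁ K × Adj G u v)) →
    ∃[ t₁ ] ∃[ t₂ ] (IsTransitivity G t₁ × IsTransitivity (complement G) t₂ × t₁ + t₂ ≡ n + 2)
  dominated-case dominated =
    let (k , k∈K) = maximumClique-nonempty G maximal vertex
        (u , u∈∁K , _) = dominated k k∈K
    in suc ∣ K ∣ , suc ∣ ∁ K ∣ ,
       dominatedClique-transitivity G clique cover (u , u∈∁K) dominated ,
       Tr-complement , trans (cong suc sizes) (sym (+-suc n 1))

  undominated-case : ¬ (∀ v → v ∈ K → ∃[ u ] (u ∈ ∁ K × Adj G u v)) →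
    ∃[ t₁ ] ∃[ t₂ ] (IsTransitivity G t₁ × IsTransitivity (complement G) t₂ × t₁ + t₂ ≡ n + 1)
  undominated-case ¬dominated =
    let (x , x∈K , isolated) = undominated-vertex G ¬dominated
    in ∣ K ∣ , suc ∣ ∁ K ∣ ,
       isolatedVertexClique-transitivity G clique cover x∈K isolated , Tr-complement , sizes
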